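{- Let $G$ be a 2-connected outerplanar near-triangulation with $V(G)=\{u,v_1,\dots,v_{2k}\}$, $k>1$, $N_G(u)=\{v_1,\dots,v_{2k}\}$, $\deg_G(v_1)=\deg_G(v_{2k})=2$, and $v_1,\dots,v_{2k}$ ordered counter-clockwise (consecutively along the outer cycle). Then the monomial $u^3v_1^0v_{2k}^0\prod_{i=2}^{2k-1}v_i^2$ vanishes in $P(G)$.
   Context: For a graph $G$, vertices are also variables and $P(G)=\prod_{xy\in E(G),\,x<y}(x-y)$ for a fixed arbitrary orientation; a monomial vanishes if its coefficient is zero. A 2-connected outerplanar near-triangulation is a 2-connected outerplanar graph embedded with all vertices on the outer cycle and all bounded faces triangles. -}

module Defs where

open import Data.Nat as ℕ using (ℕ; zero; suc; _<_; _+_; _≡ᵇ_; _<ᵇ_)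
open import Data.Fin using (Fin; toℕ)
open import Data.Bool using (Bool; true; false; if_then_else_; _∧_; _∨_)
open import Data.Integer as ℤ using (ℤ)
open import Data.List as List using (List; []; _∷_; concatMap; allFin; foldr)
open import Data.Vec as Vec using (Vec; replicate; updateAt; tabulate)
open import Data.Vec.Properties using (≡-dec)
open import Data.Nat.ListAction using (sum)
open import Data.Product using (_×_; _,_; Σ; ∃₂)
open import Data.Sum using (_⊎_)
open import Relation.Binary.PropositionalEquality using (_≡_)
open import Relation.Nullary using (¬_; does)

record Graph (n : ℕ) : Set where
  field
    adj    : Fin n → Fin n → Bool
    sym    : ∀ x y → adj x y ≡ adj y x
    irrefl : ∀ x → adj x x ≡ false
open Graph public

edges : ∀ {n} → Graph n → List (Fin n × Fin n)
edges {n} G = concatMap (λ x → concatMap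
  (λ y → if (toℕ x <ᵇ toℕ y) ∧ adj G x y then (x , y) ∷ [] else [])
  (allFin n)) (allFin n)

deg : ∀ {n} → Graph n → Fin n → ℕ
deg {n} G x = sum (List.map (λ y → if adj G x y then 1 else 0) (allFin n))

Monomial : ℕ → Set
Monomial n = Vec ℕ n

-- A polynomial in unnormalised form: a list of terms (coefficient, exponents).
Poly : ℕ → Set
Poly n = List (ℤ × Monomial n)

mulDiff : ∀ {n} → Fin n → Fin n → Poly n → Poly n
mulDiff x y = concatMap (λ { (c , e) →
  (c , updateAt e x suc) ∷ (ℤ.- c , updateAt e y suc) ∷ [] })

P : ∀ {n} → Graph n → Poly n
P {n} G = foldr (λ { (x , y) p → mulDiff x y p }) ((ℤ.+ 1 , replicate n 0) ∷ []) (edges G)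

coeff : ∀ {n} → Poly n → Monomial n → ℤ
coeff [] m = ℤ.0ℤ
coeff ((c , e) ∷ p) m = if does (≡-dec ℕ._≟_ e m) then c ℤ.+ coeff p m else coeff p m

Vanishes : ∀ {n} → Graph n → Monomial n → Set
Vanishes G m = coeff (P G) m ≡ ℤ.0ℤ

-- Chords ab and cd (vertex positions along the outer cycle) cross.
Cross : ∀ {n} → Fin n → Fin n → Fin n → Fin n → Set
Cross a b c d = (toℕ a < toℕ c) × (toℕ c < toℕ b) × (toℕ b < toℕ d)

-- G is a 2-connected outerplanar near-triangulation whose outer (Hamiltonian)
-- cycle visits the vertices in the order 0, 1, ..., n-1 (counter-clockwise):
--  * the outer cycle 0-1-...-(n-1)-0 is present,
--  * no two edges cross (outerplanar embedding with that outer cycle),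
--  * all bounded faces are triangles: the embedding is maximal, i.e. every
--    non-adjacent pair is crossed by some edge.
record OuterplanarNearTriangulation {n : ℕ} (G : Graph n) : Set where
  field
    atLeast3   : 3 ℕ.≤ n
    cycleEdge  : ∀ (i j : Fin n) → toℕ j ≡ suc (toℕ i) → adj G i j ≡ true
    closeEdge  : ∀ (i j : Fin n) → toℕ i ≡ 0 → suc (toℕ j) ≡ n → adj G i j ≡ true
    noCrossing : ∀ a b c d → adj G a b ≡ true → adj G c d ≡ true → ¬ Cross a b c d
    triangulated : ∀ a b → toℕ a < toℕ b → adj G a b ≡ false →
      ∃₂ λ c d → adj G c d ≡ true × (Cross a b c d ⊎ Cross c d a b)

-- The monomial u^3 v_1^0 v_{2k}^0 ∏_{i=2}^{2k-1} v_i^2 on vertices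
-- u = 0, v_i = i (i = 1..2k).
lemmaMonomial : (k : ℕ) → Monomial (suc (k + k))
lemmaMonomial k = tabulate λ i →
  if toℕ i ≡ᵇ 0 then 3
  else if (toℕ i ≡ᵇ 1) ∨ (toℕ i ≡ᵇ (k + k)) then 0
  else 2

{-# OPTIONS --safe #-}
module Submission where

-- The hypotheses force G to be the fan: u = 0 is joined to every v_i, and v_i v_j
-- is an edge iff |i − j| = 1, because a longer chord v_i v_j would cross the spoke
-- u v_{i+1}. The reflection u ↦ u, v_i ↦ v_{2k+1−i} is an automorphism of the fan
-- fixing the monomial; it keeps the orientation of the 2k spokes and reverses that
-- of the 2k − 1 rim edges, so it sends P(G) to −P(G), and the coefficient of an
-- invariant monomial equals its own negative.

open import Defs
open import Data.Nat using (ℕ; suc; _+_; _≤_)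
open import Data.Fin using (Fin; toℕ; zero)
open import Data.Bool using (true)
open import Relation.Binary.PropositionalEquality using (_≡_; _≢_)

open import Data.Bool using (Bool; false; T; if_then_else_; _∧_; _∨_)
open import Data.Bool.Properties using (T-≡; T-∧; ∨-comm; ⇔→≡)
open import Data.Fin using (suc; opposite; fromℕ<)
open import Data.Fin.Properties using (toℕ<n; toℕ-fromℕ<; toℕ-injective; opposite-prop; opposite-involutive)
import Data.Fin.Properties as Fin
open import Data.Integer as ℤ using (ℤ; +_; -[1+_]; 0ℤ; 1ℤ; -1ℤ; _*_; _-_; -_; _^_)
open import Data.Integer.Properties
  using (*-identityˡ; *-identityʳ; *-zeroʳ; *-assoc; +-identityˡ; -1*i≡-i; *-1-monoid)
open import Algebra.Properties.Monoid.Sum *-1-monoid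
  using () renaming (sum to ∏; sum-cong-≗ to ∏-cong; sum-replicate-zero to ∏-1)
open import Data.Integer.Tactic.RingSolver using (solve-∀)
open import Data.List using (List; []; _∷_; _++_; map; concatMap; allFin; foldr; tabulate)
open import Data.List.Membership.Propositional using (_∈_; find; lose)
open import Data.List.Membership.Propositional.Properties
  using (∈-allFin; ∈-concatMap⁺; ∈-concatMap⁻; ∈-map⁺; ∈-map⁻)
open import Data.List.Membership.Propositional.Properties.WithK using (unique∧set⇒bag)
open import Data.List.Relation.Binary.BagAndSetEquality using (∼bag⇒↭)
open import Data.List.Relation.Binary.Permutation.Propositional as Perm using (_↭_)
open import Data.List.Relation.Unary.All as All using ()
open import Data.List.Relation.Unary.AllPairs as AllPairs using ()
open import Data.List.Relation.Unary.Any using (here)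
open import Data.List.Relation.Unary.Unique.Propositional using (Unique)
open import Data.List.Relation.Unary.Unique.Propositional.Properties as Unique using ()
open import Data.Nat as ℕ using (zero; _<_; _≡ᵇ_; _<ᵇ_; s≤s; z<s)
open import Data.Nat.Properties as ℕ
  using (_≟_; +-suc; +-cancelˡ-≡; +-cancelʳ-≡; <⇒<ᵇ; <ᵇ⇒<; 0≢1+n; ≤-trans; <⇒≤; ≤∧≢⇒<; <-cmp; <-asym;
         ≤-reflexive; n≤1+n; ∸-monoʳ-<; m∸n+n≡m; suc-injective)
open import Data.Product as Product using (_×_; _,_; proj₁; proj₂)
open import Data.Sum as Sum using (_⊎_; inj₁; inj₂)
open import Data.Unit using (tt)
open import Data.Empty using (⊥-elim)
open import Data.Vec as Vec using (Vec; lookup; replicate; updateAt; _[_]≔_)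
open import Data.Vec.Properties
  using (≡-dec; lookup∘updateAt; lookup∘updateAt′; lookup∘update; lookup∘update′; updateAt-updateAt;
         []≔-lookup; []≔-commutes; lookup∘tabulate; tabulate∘lookup; tabulate-cong; lookup-replicate)
open import Function using (_∘_; id; _⇔_; mk⇔; Equivalence)
open import Function.Properties.Equivalence using () renaming (trans to ⇔-trans; sym to ⇔-sym)
open import Relation.Binary.Definitions using (tri<; tri≈; tri>)
open import Relation.Binary.PropositionalEquality
  using (refl; trans; cong; cong₂; subst; _≗_; module ≡-Reasoning)
import Relation.Binary.PropositionalEquality as ≡
open import Relation.Nullary using (¬_; does; yes; no)
open import Relation.Nullary.Decidable using (does-⇔; dec-false; _×-dec_; T?)

private variable
  n : ℕ
  A : Set

Coeffs : ℕ → Set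
Coeffs n = Monomial n → ℤ

Edge : ℕ → Set
Edge n = Fin n × Fin n

-- Coefficients of products of linear forms

atPred : ℕ → (ℕ → ℤ) → ℤ
atPred zero    g = 0ℤ
atPred (suc t) g = g t

atPred-cong : ∀ v {g h : ℕ → ℤ} → g ≗ h → atPred v g ≡ atPred v h
atPred-cong zero    _  = refl
atPred-cong (suc v) eq = eq v

atPred-comm : ∀ a b (h : ℕ → ℕ → ℤ) →
  atPred a (λ t → atPred b (h t)) ≡ atPred b (λ s → atPred a (λ t → h t s))
atPred-comm zero    zero    h = refl
atPred-comm zero    (suc b) h = refl
atPred-comm (suc a) zero    h = refl
atPred-comm (suc a) (suc b) h = refl

atPred-map : ∀ (f : ℤ → ℤ) → f 0ℤ ≡ 0ℤ → ∀ v g → atPred v (f ∘ g) ≡ f (atPred v g)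
atPred-map f f0 zero    g = ≡.sym f0
atPred-map f f0 (suc v) g = refl

atPred-map₂ : ∀ (_∙_ : ℤ → ℤ → ℤ) → 0ℤ ∙ 0ℤ ≡ 0ℤ →
  ∀ v g h → atPred v (λ t → g t ∙ h t) ≡ atPred v g ∙ atPred v h
atPred-map₂ _ zero∙zero zero    g h = ≡.sym zero∙zero
atPred-map₂ _ _         (suc v) g h = refl

-- If f is the coefficient function of p, then mulVar x f is that of x · p.
mulVar : Fin n → Coeffs n → Coeffs n
mulVar x f m = atPred (lookup m x) (λ t → f (m [ x ]≔ t))

mulVar-cong : ∀ x {f g : Coeffs n} → f ≗ g → mulVar x f ≗ mulVar x g
mulVar-cong x eq m = atPred-cong (lookup m x) (λ t → eq (m [ x ]≔ t))

mulVar-+ : ∀ x (f g : Coeffs n) m → mulVar x (λ m′ → f m′ ℤ.+ g m′) m ≡ mulVar x f m ℤ.+ mulVar x g m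
mulVar-+ x f g m = atPred-map₂ ℤ._+_ refl (lookup m x) _ _

mulVar-- : ∀ x (f g : Coeffs n) m → mulVar x (λ m′ → f m′ - g m′) m ≡ mulVar x f m - mulVar x g m
mulVar-- x f g m = atPred-map₂ _-_ refl (lookup m x) _ _

mulVar-* : ∀ x c (f : Coeffs n) m → mulVar x (λ m′ → c * f m′) m ≡ c * mulVar x f m
mulVar-* x c f m = atPred-map (c *_) (*-zeroʳ c) (lookup m x) _

mulVar-comm : ∀ x z (f : Coeffs n) → mulVar x (mulVar z f) ≗ mulVar z (mulVar x f)
mulVar-comm x z f m with x Fin.≟ z
... | yes refl = refl
... | no x≢z = begin
  atPred (lookup m x) (λ t → atPred (lookup (m [ x ]≔ t) z) (λ s → f ((m [ x ]≔ t) [ z ]≔ s)))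
    ≡⟨ atPred-cong (lookup m x) (λ t →
         cong (λ v → atPred v (λ s → f ((m [ x ]≔ t) [ z ]≔ s)))
              (lookup∘updateAt′ z x (x≢z ∘ ≡.sym) m)) ⟩
  atPred (lookup m x) (λ t → atPred (lookup m z) (λ s → f ((m [ x ]≔ t) [ z ]≔ s)))
    ≡⟨ atPred-cong (lookup m x) (λ t → atPred-cong (lookup m z) (λ s → cong f ([]≔-commutes m x z x≢z))) ⟩
  atPred (lookup m x) (λ t → atPred (lookup m z) (λ s → f ((m [ z ]≔ s) [ x ]≔ t)))
    ≡⟨ atPred-comm (lookup m x) (lookup m z) _ ⟩
  atPred (lookup m z) (λ s → atPred (lookup m x) (λ t → f ((m [ z ]≔ s) [ x ]≔ t)))
    ≡⟨ atPred-cong (lookup m z) (λ s →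
         cong (λ v → atPred v (λ t → f ((m [ z ]≔ s) [ x ]≔ t))) (lookup∘updateAt′ x z x≢z m)) ⟨
  atPred (lookup m z) (λ s → atPred (lookup (m [ z ]≔ s) x) (λ t → f ((m [ z ]≔ s) [ x ]≔ t))) ∎
  where open ≡-Reasoning

prodCoeff : List (Edge n) → Coeffs n
prodCoeff []            = coeff ((+ 1 , replicate _ 0) ∷ [])
prodCoeff ((x , y) ∷ L) m = mulVar x (prodCoeff L) m - mulVar y (prodCoeff L) m

termCoeff : ℤ × Monomial n → Coeffs n
termCoeff (c , e) m = if does (≡-dec _≟_ e m) then c else 0ℤ

coeff-∷ : ∀ t (p : Poly n) m → coeff (t ∷ p) m ≡ termCoeff t m ℤ.+ coeff p m
coeff-∷ (c , e) p m with does (≡-dec _≟_ e m)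
... | true  = refl
... | false = ≡.sym (+-identityˡ _)

termCoeff-mulVar : ∀ c (e : Monomial n) x → termCoeff (c , updateAt e x suc) ≗ mulVar x (termCoeff (c , e))
termCoeff-mulVar c e x m with lookup m x in m[x]
... | zero  = cong (λ b → if b then c else 0ℤ) (dec-false (≡-dec _≟_ _ m) x-entry-nonzero)
  where
  x-entry-nonzero : updateAt e x suc ≢ m
  x-entry-nonzero refl = 0≢1+n (trans (≡.sym m[x]) (lookup∘updateAt x e))
... | suc t = cong (λ b → if b then c else 0ℤ) (does-⇔ (mk⇔ to from) (≡-dec _≟_ _ m) (≡-dec _≟_ e _))
  where
  open ≡-Reasoning
  to : updateAt e x suc ≡ m → e ≡ m [ x ]≔ t
  to refl = begin
    e                            ≡⟨ []≔-lookup e x ⟨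
    e [ x ]≔ lookup e x          ≡⟨ cong (e [ x ]≔_) (suc-injective (trans (≡.sym (lookup∘updateAt x e)) m[x])) ⟩
    e [ x ]≔ t                   ≡⟨ updateAt-updateAt x e ⟨
    updateAt e x suc [ x ]≔ t    ∎
  from : e ≡ m [ x ]≔ t → updateAt e x suc ≡ m
  from refl = begin
    updateAt (m [ x ]≔ t) x suc  ≡⟨ updateAt-updateAt x m ⟩
    m [ x ]≔ suc t               ≡⟨ cong (m [ x ]≔_) m[x] ⟨
    m [ x ]≔ lookup m x          ≡⟨ []≔-lookup m x ⟩
    m                            ∎

coeff-mulDiff : ∀ x y (p : Poly n) m → coeff (mulDiff x y p) m ≡ mulVar x (coeff p) m - mulVar y (coeff p) m
coeff-mulDiff x y [] m with lookup m x | lookup m y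
... | zero  | zero  = refl
... | zero  | suc _ = refl
... | suc _ | zero  = refl
... | suc _ | suc _ = refl
coeff-mulDiff x y (t@(c , e) ∷ p) m = begin
  coeff ((c , updateAt e x suc) ∷ (- c , updateAt e y suc) ∷ mulDiff x y p) m
    ≡⟨ coeff-∷ (c , updateAt e x suc) ((- c , updateAt e y suc) ∷ mulDiff x y p) m ⟩
  termCoeff (c , updateAt e x suc) m ℤ.+ coeff ((- c , updateAt e y suc) ∷ mulDiff x y p) m
    ≡⟨ cong₂ ℤ._+_ (termCoeff-mulVar c e x m)
         (trans (coeff-∷ (- c , updateAt e y suc) (mulDiff x y p) m)
                (cong₂ ℤ._+_ negated-term (coeff-mulDiff x y p m))) ⟩
  tx ℤ.+ (- ty ℤ.+ (px - py))
    ≡⟨ regroup tx ty px py ⟩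
  (tx ℤ.+ px) - (ty ℤ.+ py)
    ≡⟨ cong₂ _-_ (mulVar-+ x (termCoeff t) (coeff p) m) (mulVar-+ y (termCoeff t) (coeff p) m) ⟨
  mulVar x (λ m′ → termCoeff t m′ ℤ.+ coeff p m′) m - mulVar y (λ m′ → termCoeff t m′ ℤ.+ coeff p m′) m
    ≡⟨ cong₂ _-_ (mulVar-cong x (coeff-∷ t p) m) (mulVar-cong y (coeff-∷ t p) m) ⟨
  mulVar x (coeff (t ∷ p)) m - mulVar y (coeff (t ∷ p)) m ∎
  where
  open ≡-Reasoning
  tx ty px py : ℤ
  tx = mulVar x (termCoeff t) m
  ty = mulVar y (termCoeff t) m
  px = mulVar x (coeff p) m
  py = mulVar y (coeff p) m
  regroup : ∀ a b c d → a ℤ.+ (- b ℤ.+ (c - d)) ≡ (a ℤ.+ c) - (b ℤ.+ d)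
  regroup = solve-∀
  negated-term : termCoeff (- c , updateAt e y suc) m ≡ - ty
  negated-term = trans (negate-if (does (≡-dec _≟_ (updateAt e y suc) m))) (cong -_ (termCoeff-mulVar c e y m))
    where
    negate-if : ∀ b → (if b then - c else 0ℤ) ≡ - (if b then c else 0ℤ)
    negate-if true  = refl
    negate-if false = refl

coeff-foldr-mulDiff : (step : Edge n → Poly n → Poly n) → (∀ x y p → step (x , y) p ≡ mulDiff x y p) →
  ∀ L → coeff (foldr step ((+ 1 , replicate n 0) ∷ []) L) ≗ prodCoeff L
coeff-foldr-mulDiff step step-mulDiff [] m = refl
coeff-foldr-mulDiff step step-mulDiff ((x , y) ∷ L) m =
  trans (cong (λ q → coeff q m) (step-mulDiff x y _))
    (trans (coeff-mulDiff x y (foldr step _ L) m)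
      (cong₂ _-_ (mulVar-cong x (coeff-foldr-mulDiff step step-mulDiff L) m)
                 (mulVar-cong y (coeff-foldr-mulDiff step step-mulDiff L) m)))

coeff-P : (G : Graph n) → coeff (P G) ≗ prodCoeff (edges G)
coeff-P G = coeff-foldr-mulDiff _ (λ _ _ _ → refl) (edges G)

prodCoeff-∷-cong : ∀ (e : Edge n) {L L′} → prodCoeff L ≗ prodCoeff L′ →
  prodCoeff (e ∷ L) ≗ prodCoeff (e ∷ L′)
prodCoeff-∷-cong (x , y) eq m = cong₂ _-_ (mulVar-cong x eq m) (mulVar-cong y eq m)

prodCoeff-swap : ∀ (e e′ : Edge n) L → prodCoeff (e ∷ e′ ∷ L) ≗ prodCoeff (e′ ∷ e ∷ L)
prodCoeff-swap (x , y) (z , w) L m = begin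
  mulVar x (λ m′ → Δz m′ - Δw m′) m - mulVar y (λ m′ → Δz m′ - Δw m′) m
    ≡⟨ cong₂ _-_ (mulVar-- x Δz Δw m) (mulVar-- y Δz Δw m) ⟩
  (mulVar x Δz m - mulVar x Δw m) - (mulVar y Δz m - mulVar y Δw m)
    ≡⟨ cong₂ _-_ (cong₂ _-_ (mulVar-comm x z f m) (mulVar-comm x w f m))
                 (cong₂ _-_ (mulVar-comm y z f m) (mulVar-comm y w f m)) ⟩
  (mulVar z Δx m - mulVar w Δx m) - (mulVar z Δy m - mulVar w Δy m)
    ≡⟨ interchange (mulVar z Δx m) (mulVar w Δx m) (mulVar z Δy m) (mulVar w Δy m) ⟩
  (mulVar z Δx m - mulVar z Δy m) - (mulVar w Δx m - mulVar w Δy m)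
    ≡⟨ cong₂ _-_ (mulVar-- z Δx Δy m) (mulVar-- w Δx Δy m) ⟨
  mulVar z (λ m′ → Δx m′ - Δy m′) m - mulVar w (λ m′ → Δx m′ - Δy m′) m ∎
  where
  open ≡-Reasoning
  f Δx Δy Δz Δw : Coeffs _
  f = prodCoeff L
  Δx = mulVar x f
  Δy = mulVar y f
  Δz = mulVar z f
  Δw = mulVar w f
  interchange : ∀ a b c d → (a - b) - (c - d) ≡ (a - c) - (b - d)
  interchange = solve-∀

prodCoeff-↭ : {L L′ : List (Edge n)} → L ↭ L′ → prodCoeff L ≗ prodCoeff L′
prodCoeff-↭ Perm.refl          m = refl
prodCoeff-↭ {L = _ ∷ xs} {_ ∷ ys} (Perm.prep e p) m = prodCoeff-∷-cong e {xs} {ys} (prodCoeff-↭ p) m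
prodCoeff-↭ {L = _ ∷ _ ∷ xs} {_ ∷ _ ∷ ys} (Perm.swap e e′ p) m =
  trans (prodCoeff-swap e e′ xs m)
    (prodCoeff-∷-cong e′ {e ∷ xs} {e ∷ ys} (prodCoeff-∷-cong e {xs} {ys} (prodCoeff-↭ p)) m)
prodCoeff-↭ (Perm.trans p q)   m = trans (prodCoeff-↭ p m) (prodCoeff-↭ q m)

-- Relabelling the variables

lookup-extensional : {xs ys : Vec A n} → (∀ i → lookup xs i ≡ lookup ys i) → xs ≡ ys
lookup-extensional {xs = xs} {ys} eq =
  trans (≡.sym (tabulate∘lookup xs)) (trans (tabulate-cong eq) (tabulate∘lookup ys))

module Relabel (σ : Fin n → Fin n) (σ-involutive : ∀ i → σ (σ i) ≡ i) where

  relabel : Monomial n → Monomial n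
  relabel m = Vec.tabulate (lookup m ∘ σ)

  σ-injective : ∀ {i j} → σ i ≡ σ j → i ≡ j
  σ-injective {i} {j} eq = trans (≡.sym (σ-involutive i)) (trans (cong σ eq) (σ-involutive j))

  relabel-tabulate : ∀ f → relabel (Vec.tabulate f) ≡ Vec.tabulate (f ∘ σ)
  relabel-tabulate f = tabulate-cong (lookup∘tabulate f ∘ σ)

  relabel-update : ∀ m x t → relabel (m [ σ x ]≔ t) ≡ relabel m [ x ]≔ t
  relabel-update m x t = lookup-extensional entry
    where
    entry : ∀ i → lookup (relabel (m [ σ x ]≔ t)) i ≡ lookup (relabel m [ x ]≔ t) i
    entry i with i Fin.≟ x
    ... | yes refl = trans (lookup∘tabulate _ i)
                       (trans (lookup∘update (σ i) m t) (≡.sym (lookup∘update i (relabel m) t)))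
    ... | no i≢x = trans (lookup∘tabulate _ i)
                     (trans (lookup∘update′ (i≢x ∘ σ-injective) m t)
                       (≡.sym (trans (lookup∘update′ i≢x (relabel m) t) (lookup∘tabulate _ i))))

  relabel-involutive : ∀ m → relabel (relabel m) ≡ m
  relabel-involutive m = lookup-extensional λ i →
    trans (lookup∘tabulate _ i) (trans (lookup∘tabulate _ (σ i)) (cong (lookup m) (σ-involutive i)))

  relabel-zero : relabel (replicate n 0) ≡ replicate n 0
  relabel-zero = lookup-extensional λ i →
    trans (lookup∘tabulate _ i) (trans (lookup-replicate (σ i) 0) (≡.sym (lookup-replicate i 0)))

  mulVar-relabel : ∀ x {f g : Coeffs n} → f ≗ g ∘ relabel → mulVar (σ x) f ≗ mulVar x g ∘ relabel
  mulVar-relabel x {g = g} eq m =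
    trans (atPred-cong (lookup m (σ x)) (λ t → trans (eq _) (cong g (relabel-update m x t))))
          (cong (λ v → atPred v (λ t → g (relabel m [ x ]≔ t))) (≡.sym (lookup∘tabulate (lookup m ∘ σ) x)))

  prodCoeff-map-relabel : ∀ L → prodCoeff (map (Product.map σ σ) L) ≗ prodCoeff L ∘ relabel
  prodCoeff-map-relabel [] m = cong (λ b → if b then + 1 ℤ.+ 0ℤ else 0ℤ)
    (does-⇔ (mk⇔ (λ eq → trans (≡.sym relabel-zero) (cong relabel eq))
                 (λ eq → trans (≡.sym relabel-zero) (trans (cong relabel eq) (relabel-involutive m))))
            (≡-dec _≟_ _ m) (≡-dec _≟_ _ (relabel m)))
  prodCoeff-map-relabel ((x , y) ∷ L) m = cong₂ _-_
    (mulVar-relabel x {g = prodCoeff L} (prodCoeff-map-relabel L) m)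
    (mulVar-relabel y {g = prodCoeff L} (prodCoeff-map-relabel L) m)

-- Reorienting edges

signProduct : (Edge n → ℤ) → List (Edge n) → ℤ
signProduct s []      = 1ℤ
signProduct s (e ∷ L) = s e * signProduct s L

Reorients : ℤ → Edge n → Edge n → Set
Reorients s e′ e = (e′ ≡ e × s ≡ 1ℤ) ⊎ (e′ ≡ Product.swap e × s ≡ -1ℤ)

prodCoeff-∷-scale : ∀ (e : Edge n) c {L L′} → prodCoeff L ≗ (c *_) ∘ prodCoeff L′ →
  prodCoeff (e ∷ L) ≗ (c *_) ∘ prodCoeff (e ∷ L′)
prodCoeff-∷-scale (x , y) c {L′ = L′} eq m =
  trans (cong₂ _-_ (trans (mulVar-cong x eq m) (mulVar-* x c (prodCoeff L′) m))
                   (trans (mulVar-cong y eq m) (mulVar-* y c (prodCoeff L′) m)))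
        (factor c _ _)
  where
  factor : ∀ k a b → k * a - k * b ≡ k * (a - b)
  factor = solve-∀

prodCoeff-reorient : (f g : Edge n → Edge n) (s : Edge n → ℤ) → (∀ e → Reorients (s e) (f e) (g e)) →
  ∀ L → prodCoeff (map f L) ≗ (signProduct s L *_) ∘ prodCoeff (map g L)
prodCoeff-reorient f g s reorients [] m = ≡.sym (*-identityˡ _)
prodCoeff-reorient f g s reorients (e ∷ L) m with reorients e
... | inj₁ (fe≡ge , se≡1) = begin
  prodCoeff (f e ∷ map f L) m     ≡⟨ cong (λ e′ → prodCoeff (e′ ∷ map f L) m) fe≡ge ⟩
  prodCoeff (g e ∷ map f L) m     ≡⟨ prodCoeff-∷-scale (g e) c {map f L} {map g L} rest m ⟩
  c * X                           ≡⟨ cong (_* X) (*-identityˡ c) ⟨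
  1ℤ * c * X                      ≡⟨ cong (λ z → z * c * X) se≡1 ⟨
  s e * c * X                     ∎
  where
  open ≡-Reasoning
  rest : prodCoeff (map f L) ≗ (signProduct s L *_) ∘ prodCoeff (map g L)
  rest = prodCoeff-reorient f g s reorients L
  c X : ℤ
  c = signProduct s L
  X = prodCoeff (g e ∷ map g L) m
... | inj₂ (fe≡ge˘ , se≡-1) = begin
  prodCoeff (f e ∷ map f L) m                     ≡⟨ cong (λ e′ → prodCoeff (e′ ∷ map f L) m) fe≡ge˘ ⟩
  prodCoeff (Product.swap (g e) ∷ map f L) m      ≡⟨ prodCoeff-∷-scale _ c {map f L} {map g L} rest m ⟩
  c * (Y - X)                                     ≡⟨ reverse-factor c X Y ⟩
  -1ℤ * c * (X - Y)                               ≡⟨ cong (λ z → z * c * (X - Y)) se≡-1 ⟨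
  s e * c * (X - Y)                               ∎
  where
  open ≡-Reasoning
  rest : prodCoeff (map f L) ≗ (signProduct s L *_) ∘ prodCoeff (map g L)
  rest = prodCoeff-reorient f g s reorients L
  c X Y : ℤ
  c = signProduct s L
  X = mulVar (proj₁ (g e)) (prodCoeff (map g L)) m
  Y = mulVar (proj₂ (g e)) (prodCoeff (map g L)) m
  reverse-factor : ∀ k a b → k * (b - a) ≡ -1ℤ * k * (a - b)
  reverse-factor = solve-∀

∈-if⁻ : ∀ (b : Bool) {p q : A} → q ∈ (if b then p ∷ [] else []) → T b × q ≡ p
∈-if⁻ true (here q≡p) = tt , q≡p

∈-if⁺ : ∀ {b} {p : A} → T b → p ∈ (if b then p ∷ [] else [])
∈-if⁺ {b = true} _ = here refl

unique-if : ∀ (b : Bool) (p : A) → Unique (if b then p ∷ [] else [])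
unique-if true  p = All.[] AllPairs.∷ AllPairs.[]
unique-if false p = AllPairs.[]

unique-concatMap : ∀ {B : Set} (key : B → A) (H : A → List B) {xs} → Unique xs → (∀ x → Unique (H x)) →
  (∀ {x z} → z ∈ H x → key z ≡ x) → Unique (concatMap H xs)
unique-concatMap key H {[]}     _                     _     _    = AllPairs.[]
unique-concatMap key H {x ∷ xs} (x∉xs AllPairs.∷ uxs) uH keyH =
  Unique.++⁺ (uH x) (unique-concatMap key H uxs uH keyH) disjoint
  where
  disjoint : ∀ {v} → ¬ (v ∈ H x × v ∈ concatMap H xs)
  disjoint (v∈Hx , v∈rest) with find (∈-concatMap⁻ H {xs = xs} v∈rest)
  ... | y , y∈xs , v∈Hy = All.lookup x∉xs y∈xs (trans (≡.sym (keyH v∈Hx)) (keyH v∈Hy))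

map-involution-↭ : (f : A → A) → (∀ x → f (f x) ≡ x) → ∀ {xs} → Unique xs →
  (∀ {x} → x ∈ xs → f x ∈ xs) → map f xs ↭ xs
map-involution-↭ f f-involutive {xs} uxs closed =
  ∼bag⇒↭ (unique∧set⇒bag (Unique.map⁺ f-injective uxs) uxs (mk⇔ to from))
  where
  f-injective : ∀ {x y} → f x ≡ f y → x ≡ y
  f-injective {x} {y} eq = trans (≡.sym (f-involutive x)) (trans (cong f eq) (f-involutive y))
  to : ∀ {z} → z ∈ map f xs → z ∈ xs
  to z∈ with ∈-map⁻ f z∈
  ... | _ , x∈ , refl = closed x∈
  from : ∀ {z} → z ∈ xs → z ∈ map f xs
  from {z} z∈ = subst (_∈ map f xs) (f-involutive z) (∈-map⁺ f (closed z∈))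

module _ (G : Graph n) where

  edgeIf : Fin n → Fin n → List (Edge n)
  edgeIf x y = if (toℕ x <ᵇ toℕ y) ∧ adj G x y then (x , y) ∷ [] else []

  edgesFrom : Fin n → List (Edge n)
  edgesFrom x = concatMap (edgeIf x) (allFin n)

  ∈-edges⁻ : ∀ {x y} → (x , y) ∈ edges G → toℕ x < toℕ y × adj G x y ≡ true
  ∈-edges⁻ e∈ with find (∈-concatMap⁻ edgesFrom {xs = allFin n} e∈)
  ... | a , _ , e∈a with find (∈-concatMap⁻ (edgeIf a) {xs = allFin n} e∈a)
  ... | b , _ , e∈ab with ∈-if⁻ ((toℕ a <ᵇ toℕ b) ∧ adj G a b) e∈ab
  ... | test , refl with Equivalence.to T-∧ test
  ...   | x<y , xy = <ᵇ⇒< _ _ x<y , Equivalence.to T-≡ xy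

  ∈-edges⁺ : ∀ {x y} → toℕ x < toℕ y → adj G x y ≡ true → (x , y) ∈ edges G
  ∈-edges⁺ {x} {y} x<y xy = ∈-concatMap⁺ edgesFrom (lose (∈-allFin x)
    (∈-concatMap⁺ (edgeIf x) (lose (∈-allFin y)
      (∈-if⁺ (Equivalence.from T-∧ (<⇒<ᵇ x<y , Equivalence.from T-≡ xy))))))

  edges-unique : Unique (edges G)
  edges-unique = unique-concatMap proj₁ edgesFrom (Unique.allFin⁺ n) from-unique source
    where
    from-unique : ∀ x → Unique (edgesFrom x)
    from-unique x = unique-concatMap proj₂ (edgeIf x) (Unique.allFin⁺ n) (λ y → unique-if _ (x , y))
      (λ z∈ → cong proj₂ (proj₂ (∈-if⁻ _ z∈)))
    source : ∀ {x z} → z ∈ edgesFrom x → proj₁ z ≡ x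
    source {x} z∈ with find (∈-concatMap⁻ (edgeIf x) {xs = allFin n} z∈)
    ... | y , _ , z∈xy = cong proj₁ (proj₂ (∈-if⁻ _ z∈xy))

signProduct-++ : ∀ (s : Edge n → ℤ) xs ys → signProduct s (xs ++ ys) ≡ signProduct s xs * signProduct s ys
signProduct-++ s []       ys = ≡.sym (*-identityˡ _)
signProduct-++ s (e ∷ xs) ys = trans (cong (s e *_) (signProduct-++ s xs ys)) (≡.sym (*-assoc (s e) _ _))

signProduct-concatMap : ∀ (s : Edge n → ℤ) m (f : Fin m → A) H →
  signProduct s (concatMap H (tabulate f)) ≡ ∏ (λ i → signProduct s (H (f i)))
signProduct-concatMap s zero    f H = refl
signProduct-concatMap s (suc m) f H =
  trans (signProduct-++ s (H (f zero)) _) (cong (signProduct s (H (f zero)) *_) (signProduct-concatMap s m (f ∘ suc) H))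

signProduct-if : ∀ (s : Edge n → ℤ) b e → signProduct s (if b then e ∷ [] else []) ≡ (if b then s e else 1ℤ)
signProduct-if s true  e = *-identityʳ (s e)
signProduct-if s false e = refl

∏-indicator : ∀ m c v → ∏ {m} (λ b → if c ≡ᵇ toℕ b then v else 1ℤ) ≡ (if c <ᵇ m then v else 1ℤ)
∏-indicator zero    c       v = refl
∏-indicator (suc m) zero    v = trans (cong (v *_) (∏-1 m)) (*-identityʳ v)
∏-indicator (suc m) (suc c) v = trans (*-identityˡ _) (∏-indicator m c v)

∏-prefix : ∀ c m v → c ≤ m → ∏ {m} (λ a → if toℕ a <ᵇ c then v else 1ℤ) ≡ v ^ c
∏-prefix zero    m       v _         = ∏-1 m
∏-prefix (suc c) (suc m) v (s≤s c≤m) = cong (v *_) (∏-prefix c m v c≤m)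

-1^-even : ∀ j → -1ℤ ^ (j + j) ≡ 1ℤ
-1^-even zero    = refl
-1^-even (suc j) rewrite +-suc j j | -1^-even j = refl

-1^-odd : ∀ j → -1ℤ ^ (j + suc j) ≡ -1ℤ
-1^-odd j rewrite +-suc j j | -1^-even j = refl

self-negation⇒0 : ∀ {i} → i ≡ - i → i ≡ 0ℤ
self-negation⇒0 {+ zero}   _  = refl
self-negation⇒0 {+ suc _}  ()
self-negation⇒0 { -[1+ _ ]} ()

-- The reflection of the fan

Consecutive : Fin n → Fin n → Set
Consecutive i k = suc (toℕ i) ≡ toℕ k ⊎ suc (toℕ k) ≡ toℕ i

+-cancel-⇔ : ∀ {a b c d} → a + b ≡ c + d → (a ≡ c ⇔ b ≡ d)
+-cancel-⇔ {a} {b} {c} {d} eq = mk⇔ (λ { refl → +-cancelˡ-≡ a b d eq }) (λ { refl → +-cancelʳ-≡ b a c eq })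

toℕ-opposite+suc : ∀ (i : Fin n) → toℕ (opposite i) + suc (toℕ i) ≡ n
toℕ-opposite+suc i = trans (cong (_+ suc (toℕ i)) (opposite-prop i)) (m∸n+n≡m (toℕ<n i))

opposite-< : ∀ {i k : Fin n} → toℕ i < toℕ k → toℕ (opposite k) < toℕ (opposite i)
opposite-< {i = i} {k} i<k rewrite opposite-prop i | opposite-prop k = ∸-monoʳ-< (s≤s i<k) (toℕ<n k)

suc-opposite⇔ : ∀ (i k : Fin n) → suc (toℕ (opposite i)) ≡ toℕ (opposite k) ⇔ suc (toℕ k) ≡ toℕ i
suc-opposite⇔ i k = mk⇔ (≡.sym ∘ Equivalence.to shift) (Equivalence.from shift ∘ ≡.sym)
  where
  shift : suc (toℕ (opposite i)) ≡ toℕ (opposite k) ⇔ toℕ i ≡ suc (toℕ k)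
  shift = +-cancel-⇔ (trans (≡.sym (+-suc _ (toℕ i))) (trans (toℕ-opposite+suc i) (≡.sym (toℕ-opposite+suc k))))

opposite-consecutive : ∀ (i k : Fin n) → Consecutive (opposite i) (opposite k) ⇔ Consecutive i k
opposite-consecutive i k = mk⇔
  Sum.[ inj₂ ∘ Equivalence.to (suc-opposite⇔ i k) , inj₁ ∘ Equivalence.to (suc-opposite⇔ k i) ]
  Sum.[ inj₂ ∘ Equivalence.from (suc-opposite⇔ k i) , inj₁ ∘ Equivalence.from (suc-opposite⇔ i k) ]

opposite-endpoint : ∀ (i : Fin n) → let j = toℕ (opposite i) in
  ((j ≡ᵇ 0) ∨ (suc j ≡ᵇ n)) ≡ ((toℕ i ≡ᵇ 0) ∨ (suc (toℕ i) ≡ᵇ n))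
opposite-endpoint {n} i = trans (cong₂ _∨_ first last) (∨-comm (suc (toℕ i) ≡ᵇ n) (toℕ i ≡ᵇ 0))
  where
  j : ℕ
  j = toℕ (opposite i)
  first : (j ≡ᵇ 0) ≡ (suc (toℕ i) ≡ᵇ n)
  first = does-⇔ (+-cancel-⇔ (toℕ-opposite+suc i)) (j ≟ 0) (suc (toℕ i) ≟ n)
  last : (suc j ≡ᵇ n) ≡ (toℕ i ≡ᵇ 0)
  last = does-⇔ (+-cancel-⇔ (trans (≡.sym (+-suc j (toℕ i)))
                                   (trans (toℕ-opposite+suc i) (≡.sym (ℕ.+-identityʳ n)))))
                (suc j ≟ n) (toℕ i ≟ 0)

reflect : Fin (suc n) → Fin (suc n)
reflect zero    = zero
reflect (suc i) = suc (opposite i)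

reflect-involutive : ∀ (i : Fin (suc n)) → reflect (reflect i) ≡ i
reflect-involutive zero    = refl
reflect-involutive (suc i) = cong suc (opposite-involutive i)

-- Since reflect reverses the order of 1, …, n, this lists the reflected edge
-- with its smaller end first.
reflectEdge : Edge (suc n) → Edge (suc n)
reflectEdge (zero  , y)     = zero , reflect y
reflectEdge (suc a , zero)  = reflect (suc a) , zero
reflectEdge (suc a , suc b) = reflect (suc b) , reflect (suc a)

reflectEdge-involutive : ∀ (e : Edge (suc n)) → reflectEdge (reflectEdge e) ≡ e
reflectEdge-involutive (zero  , y)     = cong (zero ,_) (reflect-involutive y)
reflectEdge-involutive (suc a , zero)  = cong (_, zero) (reflect-involutive (suc a))
reflectEdge-involutive (suc a , suc b) = cong₂ _,_ (reflect-involutive (suc a)) (reflect-involutive (suc b))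

rimSign : Edge (suc n) → ℤ
rimSign (suc _ , suc _) = -1ℤ
rimSign _               = 1ℤ

reflect-reorients : ∀ (e : Edge (suc n)) → Reorients (rimSign e) (Product.map reflect reflect e) (reflectEdge e)
reflect-reorients (zero  , y)     = inj₁ (refl , refl)
reflect-reorients (suc a , zero)  = inj₁ (refl , refl)
reflect-reorients (suc a , suc b) = inj₂ (refl , refl)

reflect-lemmaMonomial : ∀ k →
  Relabel.relabel {suc (k + k)} reflect reflect-involutive (lemmaMonomial k) ≡ lemmaMonomial k
reflect-lemmaMonomial k = trans (relabel-tabulate exponent) (tabulate-cong {f = exponent ∘ reflect} {exponent} λ
  { zero    → refl
  ; (suc i) → cong (λ b → if b then 0 else 2) (opposite-endpoint i)
  })
  where
  open Relabel {suc (k + k)} reflect reflect-involutive using (relabel-tabulate)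
  exponent : Fin (suc (k + k)) → ℕ
  exponent i = if toℕ i ≡ᵇ 0 then 3 else if (toℕ i ≡ᵇ 1) ∨ (toℕ i ≡ᵇ k + k) then 0 else 2

module Fan {M : ℕ} (G : Graph (suc (suc M))) (ont : OuterplanarNearTriangulation G)
           (hub : ∀ i → i ≢ zero → adj G zero i ≡ true) where

  open OuterplanarNearTriangulation ont
  open Relabel {suc (suc M)} reflect reflect-involutive

  long-chord-absent : ∀ (i k : Fin (suc M)) → suc (toℕ i) < toℕ k → adj G (suc i) (suc k) ≢ true
  long-chord-absent i k i+1<k ik = noCrossing zero c (suc i) (suc k) (hub c c≢0) ik (z<s , i<c , c<k)
    where
    bound : suc (suc (toℕ i)) < suc (suc M)
    bound = s≤s (≤-trans i+1<k (<⇒≤ (toℕ<n k)))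
    c : Fin (suc (suc M))
    c = fromℕ< bound
    c≢0 : c ≢ zero
    c≢0 c≡0 = 0≢1+n (trans (≡.sym (cong toℕ c≡0)) (toℕ-fromℕ< bound))
    i<c : suc (toℕ i) < toℕ c
    i<c = ≤-reflexive (≡.sym (toℕ-fromℕ< bound))
    c<k : toℕ c < suc (toℕ k)
    c<k = s≤s (≤-trans (≤-reflexive (toℕ-fromℕ< bound)) i+1<k)

  rim-adjacent⇔consecutive : ∀ (i k : Fin (suc M)) → adj G (suc i) (suc k) ≡ true ⇔ Consecutive i k
  rim-adjacent⇔consecutive i k = mk⇔ to from
    where
    to : adj G (suc i) (suc k) ≡ true → Consecutive i k
    to ik with <-cmp (toℕ i) (toℕ k)
    ... | tri< i<k _ _ with suc (toℕ i) ≟ toℕ k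
    ...   | yes i+1≡k = inj₁ i+1≡k
    ...   | no  i+1≢k = ⊥-elim (long-chord-absent i k (≤∧≢⇒< i<k i+1≢k) ik)
    to ik | tri≈ _ i≡k _ with toℕ-injective i≡k
    ... | refl with trans (≡.sym ik) (irrefl G (suc i))
    ...   | ()
    to ik | tri> _ _ k<i with suc (toℕ k) ≟ toℕ i
    ...   | yes k+1≡i = inj₂ k+1≡i
    ...   | no  k+1≢i = ⊥-elim (long-chord-absent k i (≤∧≢⇒< k<i k+1≢i) (trans (Graph.sym G _ _) ik))
    from : Consecutive i k → adj G (suc i) (suc k) ≡ true
    from (inj₁ i+1≡k) = cycleEdge (suc i) (suc k) (cong suc (≡.sym i+1≡k))
    from (inj₂ k+1≡i) = trans (Graph.sym G _ _) (cycleEdge (suc k) (suc i) (cong suc (≡.sym k+1≡i)))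

  reflect-adj : ∀ a b → adj G (reflect a) (reflect b) ≡ adj G a b
  reflect-adj zero    zero    = refl
  reflect-adj zero    (suc k) = trans (hub _ (λ ())) (≡.sym (hub _ (λ ())))
  reflect-adj (suc i) zero    = trans (Graph.sym G _ _) (trans (reflect-adj zero (suc i)) (Graph.sym G _ _))
  reflect-adj (suc i) (suc k) = ⇔→≡ (⇔-trans (rim-adjacent⇔consecutive (opposite i) (opposite k))
    (⇔-trans (opposite-consecutive i k) (⇔-sym (rim-adjacent⇔consecutive i k))))

  reflectEdge-∈ : ∀ {e} → e ∈ edges G → reflectEdge e ∈ edges G
  reflectEdge-∈ {zero  , zero}  e∈ with ∈-edges⁻ G e∈
  ... | () , _
  reflectEdge-∈ {zero  , suc b} _  = ∈-edges⁺ G z<s (hub _ (λ ()))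
  reflectEdge-∈ {suc a , zero}  e∈ with ∈-edges⁻ G e∈
  ... | () , _
  reflectEdge-∈ {suc a , suc b} e∈ with ∈-edges⁻ G e∈
  ... | s≤s a<b , ab = ∈-edges⁺ G (s≤s (opposite-< a<b))
    (trans (reflect-adj (suc b) (suc a)) (trans (Graph.sym G _ _) ab))

  rim-edge-test : ∀ i k → (toℕ i <ᵇ toℕ k) ∧ adj G (suc i) (suc k) ≡ (suc (toℕ i) ≡ᵇ toℕ k)
  rim-edge-test i k =
    does-⇔ (mk⇔ to from) ((toℕ i ℕ.<? toℕ k) ×-dec T? (adj G (suc i) (suc k))) (suc (toℕ i) ≟ toℕ k)
    where
    to : toℕ i < toℕ k × T (adj G (suc i) (suc k)) → suc (toℕ i) ≡ toℕ k
    to (i<k , ik) with Equivalence.to (rim-adjacent⇔consecutive i k) (Equivalence.to T-≡ ik)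
    ... | inj₁ i+1≡k = i+1≡k
    ... | inj₂ k+1≡i = ⊥-elim (<-asym i<k (≤-reflexive k+1≡i))
    from : suc (toℕ i) ≡ toℕ k → toℕ i < toℕ k × T (adj G (suc i) (suc k))
    from i+1≡k =
      ≤-reflexive i+1≡k , Equivalence.from T-≡ (Equivalence.from (rim-adjacent⇔consecutive i k) (inj₁ i+1≡k))

  rowSign : Fin (suc (suc M)) → ℤ
  rowSign zero    = 1ℤ
  rowSign (suc i) = if toℕ i <ᵇ M then -1ℤ else 1ℤ

  edgesFrom-sign : ∀ x → signProduct rimSign (edgesFrom G x) ≡ rowSign x
  edgesFrom-sign zero =
    trans (signProduct-concatMap rimSign _ id (edgeIf G zero)) (trans (∏-cong spoke) (∏-1 (suc (suc M))))
    where
    spoke : ∀ y → signProduct rimSign (edgeIf G zero y) ≡ 1ℤ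
    spoke y with (0 <ᵇ toℕ y) ∧ adj G zero y
    ... | true  = refl
    ... | false = refl
  edgesFrom-sign (suc i) = trans (signProduct-concatMap rimSign _ id (edgeIf G (suc i)))
    (trans (∏-cong rim) (∏-indicator (suc (suc M)) (suc (suc (toℕ i))) -1ℤ))
    where
    rim : ∀ y → signProduct rimSign (edgeIf G (suc i) y) ≡ (if suc (suc (toℕ i)) ≡ᵇ toℕ y then -1ℤ else 1ℤ)
    rim zero    = refl
    rim (suc k) = trans (signProduct-if rimSign ((toℕ i <ᵇ toℕ k) ∧ adj G (suc i) (suc k)) (suc i , suc k))
                        (cong (λ b → if b then -1ℤ else 1ℤ) (rim-edge-test i k))

  edges-sign : signProduct rimSign (edges G) ≡ -1ℤ ^ M
  edges-sign = begin
    signProduct rimSign (edges G)                          ≡⟨ signProduct-concatMap rimSign _ id (edgesFrom G) ⟩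
    ∏ (λ x → signProduct rimSign (edgesFrom G x))          ≡⟨ ∏-cong edgesFrom-sign ⟩
    1ℤ * ∏ {suc M} (λ i → if toℕ i <ᵇ M then -1ℤ else 1ℤ) ≡⟨ *-identityˡ _ ⟩
    ∏ {suc M} (λ i → if toℕ i <ᵇ M then -1ℤ else 1ℤ)      ≡⟨ ∏-prefix M (suc M) -1ℤ (n≤1+n M) ⟩
    -1ℤ ^ M                                                ∎
    where open ≡-Reasoning

  coeff-reflect : ∀ m → coeff (P G) (relabel m) ≡ -1ℤ ^ M * coeff (P G) m
  coeff-reflect m = begin
    coeff (P G) (relabel m)                                          ≡⟨ coeff-P G (relabel m) ⟩
    prodCoeff (edges G) (relabel m)                                  ≡⟨ prodCoeff-map-relabel (edges G) m ⟨
    prodCoeff (map (Product.map reflect reflect) (edges G)) m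
      ≡⟨ prodCoeff-reorient _ reflectEdge rimSign reflect-reorients (edges G) m ⟩
    signProduct rimSign (edges G) * prodCoeff (map reflectEdge (edges G)) m
      ≡⟨ cong₂ _*_ edges-sign (prodCoeff-↭ reflectEdge-↭ m) ⟩
    -1ℤ ^ M * prodCoeff (edges G) m                                  ≡⟨ cong (-1ℤ ^ M *_) (coeff-P G m) ⟨
    -1ℤ ^ M * coeff (P G) m                                          ∎
    where
    open ≡-Reasoning
    reflectEdge-↭ : map reflectEdge (edges G) ↭ edges G
    reflectEdge-↭ = map-involution-↭ reflectEdge reflectEdge-involutive (edges-unique G) reflectEdge-∈

lemma4p6 : (k : ℕ) → 2 ≤ k → (G : Graph (suc (k + k))) →
    OuterplanarNearTriangulation G →
    (∀ (i : Fin (suc (k + k))) → i ≢ zero → adj G zero i ≡ true) →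
    (∀ (i : Fin (suc (k + k))) → toℕ i ≡ 1 → deg G i ≡ 2) →
    (∀ (i : Fin (suc (k + k))) → toℕ i ≡ k + k → deg G i ≡ 2) →
    Vanishes G (lemmaMonomial k)
lemma4p6 zero    ()
lemma4p6 (suc j) _ G ont hub _ _ = self-negation⇒0 (begin
  c                                    ≡⟨ cong (coeff (P G)) (reflect-lemmaMonomial (suc j)) ⟨
  coeff (P G) (relabel μ)              ≡⟨ Fan.coeff-reflect {j + suc j} G ont hub μ ⟩
  -1ℤ ^ (j + suc j) * c                ≡⟨ cong (_* c) (-1^-odd j) ⟩
  -1ℤ * c                              ≡⟨ -1*i≡-i c ⟩
  - c                                  ∎)
  where
  open ≡-Reasoning
  open Relabel {suc (suc (j + suc j))} reflect reflect-involutive using (relabel)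
  μ : Monomial (suc (suc j + suc j))
  μ = lemmaMonomial (suc j)
  c : ℤ
  c = coeff (P G) μ
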